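{- Let $P$ be a set of pairwise non-attacking rooks in $\{1,\dots,n\}^3$, let $I,J,K\subseteq N=\{1,\dots,n\}$ with $|I|=a,|J|=b,|K|=c$, $T_0=I\times J\times K$, $T_3=I^c\times J^c\times K^c$, let $c_0,c_3$ be the numbers of rooks of $P$ in $T_0,T_3$, $\operatorname{def}(T_0,T_3)=n^2-(a+b+c)n+ab+bc+ca-c_0-c_3$ and $\operatorname{def}(H)=n^2-|P|$. Then $$\operatorname{def}(T_0,T_3)=\operatorname{def}(H)-E_y(I^c\times N\times K)-E_z(I\times J^c\times N)-E_x(N\times J\times K^c).$$
   Context: Two rooks are non-attacking if they agree in at most one coordinate. A file of direction $x$ is $\{(t,j,k):t\in N\}$ for fixed $(j,k)$, similarly for $y,z$. For a brick $X$ with full range $N$ in direction $x$, $E_x(X)$ is the number of $x$-directional files in $X$ containing no rook of $P$; $E_y,E_z$ analogously. In the paper's notation the three bricks are $T_{1a}\cup T_{2ab}$, $T_{1b}\cup T_{2bc}$, $T_{1c}\cup T_{2ac}$ with $T_{1a}=I^c\times J\times K$, $T_{2ab}=I^c\times J^c\times K$, $T_{1b}=I\times J^c\times K$, $T_{2bc}=I\times J^c\times K^c$, $T_{1c}=I\times J\times K^c$, $T_{2ac}=I^c\times J\times K^c$. -}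

module Defs where

open import Data.Nat using (ℕ)
open import Data.Fin using (Fin)
open import Data.Fin.Subset using (Subset; _∈_; _∉_)
open import Data.Fin.Subset.Properties using (_∈?_)
open import Data.List using (List; length; filter; allFin; cartesianProduct)
open import Data.List.Relation.Unary.Any using (Any; any?)
open import Data.Product using (_×_; _,_; proj₁; proj₂)
open import Relation.Nullary using (¬_; ¬?)
open import Relation.Nullary.Decidable using (_×-dec_)
open import Relation.Binary.PropositionalEquality using (_≡_)
open import Data.Fin using (_≟_)

Cell : ℕ → Set
Cell n = Fin n × Fin n × Fin n

cx cy cz : ∀ {n} → Cell n → Fin n
cx (i , j , k) = i
cy (i , j , k) = j
cz (i , j , k) = k

NonAttacking : ∀ {n} → Cell n → Cell n → Set
NonAttacking p q =
  ¬ (cx p ≡ cx q × cy p ≡ cy q) ×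
  ¬ (cy p ≡ cy q × cz p ≡ cz q) ×
  ¬ (cx p ≡ cx q × cz p ≡ cz q)

rooksIn : ∀ {n} → Subset n → Subset n → Subset n → List (Cell n) → ℕ
rooksIn A B C P =
  length (filter (λ p → (cx p ∈? A) ×-dec ((cy p ∈? B) ×-dec (cz p ∈? C))) P)

pairs : ∀ n → List (Fin n × Fin n)
pairs n = cartesianProduct (allFin n) (allFin n)

-- E_x(N × B × C): number of x-directional files {(t,j,k) : t ∈ N},
-- j ∈ B, k ∈ C, containing no rook of P.
Ex : ∀ {n} → Subset n → Subset n → List (Cell n) → ℕ
Ex {n} B C P = length (filter
  (λ jk → (proj₁ jk ∈? B) ×-dec ((proj₂ jk ∈? C) ×-dec
     ¬? (any? (λ p → (cy p ≟ proj₁ jk) ×-dec (cz p ≟ proj₂ jk)) P)))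
  (pairs n))

-- E_y(A × N × C): number of y-directional files {(i,t,k) : t ∈ N},
-- i ∈ A, k ∈ C, containing no rook of P.
Ey : ∀ {n} → Subset n → Subset n → List (Cell n) → ℕ
Ey {n} A C P = length (filter
  (λ ik → (proj₁ ik ∈? A) ×-dec ((proj₂ ik ∈? C) ×-dec
     ¬? (any? (λ p → (cx p ≟ proj₁ ik) ×-dec (cz p ≟ proj₂ ik)) P)))
  (pairs n))

-- E_z(A × B × N): number of z-directional files {(i,j,t) : t ∈ N},
-- i ∈ A, j ∈ B, containing no rook of P.
Ez : ∀ {n} → Subset n → Subset n → List (Cell n) → ℕ
Ez {n} A B P = length (filter
  (λ ij → (proj₁ ij ∈? A) ×-dec ((proj₂ ij ∈? B) ×-dec
     ¬? (any? (λ p → (cx p ≟ proj₁ ij) ×-dec (cy p ≟ proj₂ ij)) P)))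
  (pairs n))

-- Every cell of the cube lies in exactly one of T₀, T₃ and the three bricks
-- Iᶜ × N × K, I × Jᶜ × N and N × J × Kᶜ.  In the brick Iᶜ × N × K the y-files are
-- indexed by Iᶜ × K, and no two non-attacking rooks share a file, so the rooks of
-- the brick occupy pairwise distinct files: E_y = |Iᶜ| |K| − (rooks in the brick),
-- and likewise for the other two bricks.  Adding up the five parts accounts for
-- every rook of P; with |Iᶜ| = n − a etc. what is left is a ring identity in ℤ.
module Submission where

open import Defs

module Counting where

  open import Data.Bool using (Bool; true; false; _∧_; _∨_; not)
  open import Data.Bool.Properties using (∧-identityʳ)
  open import Data.Empty using (⊥-elim)
  open import Data.Fin using (Fin; zero; suc)
  open import Data.Fin.Properties using (_≟_)
  open import Data.Fin.Subset using (Subset; ∁; ∣_∣; inside; outside)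
  open import Data.Fin.Subset.Properties using (_∈?_; ∣∁p∣≡n∸∣p∣; ∣p∣≤n)
  open import Data.List using (List; []; _∷_; length; filter; map; tabulate; cartesianProduct; _++_)
  open import Data.List.Properties using (length-++; filter-++; map-tabulate)
  open import Data.List.Relation.Unary.All using (All; []; _∷_)
  open import Data.List.Relation.Unary.AllPairs as AllPairs using (AllPairs; []; _∷_)
  open import Data.List.Relation.Unary.Any using (any?)
  open import Data.Nat using (ℕ; zero; suc; _+_; _*_)
  open import Data.Nat.Properties using (+-*-semiring; +-identityʳ; +-assoc; m∸n+n≡m)
  open import Algebra.Properties.Semiring.Sum +-*-semiring
    using (sum-syntax; sum-cong-≗; sum-replicate-zero; ∑-distrib-+; *-distribˡ-sum; *-distribʳ-sum)
  open import Data.Nat.Tactic.RingSolver using (solve-∀)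
  open import Data.Product using (_×_; _,_; proj₁; proj₂)
  open import Data.Vec using ([]; _∷_)
  open import Relation.Nullary using (¬_; does; yes; no)
  open import Relation.Nullary.Decidable using (_×-dec_)
  open import Relation.Unary using (Pred; Decidable)
  open import Relation.Binary.PropositionalEquality
  open ≡-Reasoning

  𝟙 : Bool → ℕ
  𝟙 true  = 1
  𝟙 false = 0

  𝟙-∧ : ∀ x y → 𝟙 (x ∧ y) ≡ 𝟙 x * 𝟙 y
  𝟙-∧ true  y = sym (+-identityʳ (𝟙 y))
  𝟙-∧ false y = refl

  module _ {a p} {A : Set a} {P : Pred A p} (P? : Decidable P) where

    length-filter-∷ : ∀ x xs → length (filter P? (x ∷ xs)) ≡ 𝟙 (does (P? x)) + length (filter P? xs)
    length-filter-∷ x xs with does (P? x)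
    ... | true  = refl
    ... | false = refl

    length-filter-tabulate : ∀ {n} (f : Fin n → A) →
      length (filter P? (tabulate f)) ≡ ∑[ i < n ] 𝟙 (does (P? (f i)))
    length-filter-tabulate {zero}  f = refl
    length-filter-tabulate {suc n} f = trans (length-filter-∷ (f zero) (tabulate (λ i → f (suc i))))
      (cong (𝟙 (does (P? (f zero))) +_) (length-filter-tabulate (λ i → f (suc i))))

  length-filter-cartesianProduct : ∀ {b c p} {B : Set b} {C : Set c} {P : Pred (B × C) p}
    (P? : Decidable P) {m n} (f : Fin m → B) (g : Fin n → C) →
    length (filter P? (cartesianProduct (tabulate f) (tabulate g)))
      ≡ ∑[ i < m ] ∑[ k < n ] 𝟙 (does (P? (f i , g k)))
  length-filter-cartesianProduct P? {zero}  f g = refl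
  length-filter-cartesianProduct {B = B} {C} P? {suc m} f g = begin
    length (filter P? (map (f zero ,_) (tabulate g) ++ rest))
      ≡⟨ cong length (filter-++ P? (map (f zero ,_) (tabulate g)) rest) ⟩
    length (filter P? (map (f zero ,_) (tabulate g)) ++ filter P? rest)
      ≡⟨ length-++ (filter P? (map (f zero ,_) (tabulate g))) ⟩
    length (filter P? (map (f zero ,_) (tabulate g))) + length (filter P? rest)
      ≡⟨ cong₂ _+_ (trans (cong (λ xs → length (filter P? xs)) (map-tabulate g (f zero ,_)))
                          (length-filter-tabulate P? (λ k → f zero , g k)))
                   (length-filter-cartesianProduct P? (λ i → f (suc i)) g) ⟩
    ∑[ i < suc m ] ∑[ k < _ ] 𝟙 (does (P? (f i , g k))) ∎
    where
    rest : List (B × C)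
    rest = cartesianProduct (tabulate (λ i → f (suc i))) (tabulate g)

  +-interchange₅ : ∀ a b c d e a′ b′ c′ d′ e′ →
    (a + a′) + (b + b′) + (c + c′) + (d + d′) + (e + e′) ≡ (a + b + c + d + e) + (a′ + b′ + c′ + d′ + e′)
  +-interchange₅ = solve-∀

  module _ {a} {A : Set a} {p₁ p₂ p₃ p₄ p₅}
    {P₁ : Pred A p₁} {P₂ : Pred A p₂} {P₃ : Pred A p₃} {P₄ : Pred A p₄} {P₅ : Pred A p₅}
    (P₁? : Decidable P₁) (P₂? : Decidable P₂) (P₃? : Decidable P₃) (P₄? : Decidable P₄) (P₅? : Decidable P₅)
    (exactly-one : ∀ x →
      𝟙 (does (P₁? x)) + 𝟙 (does (P₂? x)) + 𝟙 (does (P₃? x)) + 𝟙 (does (P₄? x)) + 𝟙 (does (P₅? x)) ≡ 1)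
    where

    length-filter-partition₅ : ∀ xs →
      length (filter P₁? xs) + length (filter P₂? xs) + length (filter P₃? xs)
        + length (filter P₄? xs) + length (filter P₅? xs) ≡ length xs
    length-filter-partition₅ []       = refl
    length-filter-partition₅ (x ∷ xs) = begin
      count P₁? (x ∷ xs) + count P₂? (x ∷ xs) + count P₃? (x ∷ xs) + count P₄? (x ∷ xs) + count P₅? (x ∷ xs)
        ≡⟨ cong₂ _+_ (cong₂ _+_ (cong₂ _+_ (cong₂ _+_ (length-filter-∷ P₁? x xs) (length-filter-∷ P₂? x xs))
             (length-filter-∷ P₃? x xs)) (length-filter-∷ P₄? x xs)) (length-filter-∷ P₅? x xs) ⟩
      (χ P₁? + count P₁? xs) + (χ P₂? + count P₂? xs) + (χ P₃? + count P₃? xs)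
        + (χ P₄? + count P₄? xs) + (χ P₅? + count P₅? xs)
        ≡⟨ +-interchange₅ (χ P₁?) (χ P₂?) (χ P₃?) (χ P₄?) (χ P₅?)
             (count P₁? xs) (count P₂? xs) (count P₃? xs) (count P₄? xs) (count P₅? xs) ⟩
      (χ P₁? + χ P₂? + χ P₃? + χ P₄? + χ P₅?)
        + (count P₁? xs + count P₂? xs + count P₃? xs + count P₄? xs + count P₅? xs)
        ≡⟨ cong₂ _+_ (exactly-one x) (length-filter-partition₅ xs) ⟩
      suc (length xs) ∎
      where
      χ : ∀ {q} {Q : Pred A q} → Decidable Q → ℕ
      χ Q? = 𝟙 (does (Q? x))

      count : ∀ {q} {Q : Pred A q} → Decidable Q → List A → ℕ
      count Q? ys = length (filter Q? ys)

  ∑-𝟙-∈ : ∀ {n} (s : Subset n) → ∑[ i < n ] 𝟙 (does (i ∈? s)) ≡ ∣ s ∣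
  ∑-𝟙-∈ []            = refl
  ∑-𝟙-∈ (inside  ∷ s) = cong suc (∑-𝟙-∈ s)
  ∑-𝟙-∈ (outside ∷ s) = ∑-𝟙-∈ s

  ∑∑-𝟙-∈× : ∀ {n} (s t : Subset n) →
    ∑[ i < n ] ∑[ k < n ] 𝟙 (does (i ∈? s) ∧ does (k ∈? t)) ≡ ∣ s ∣ * ∣ t ∣
  ∑∑-𝟙-∈× {n} s t = begin
    ∑[ i < n ] ∑[ k < n ] 𝟙 (does (i ∈? s) ∧ does (k ∈? t))
      ≡⟨ sum-cong-≗ (λ i → sum-cong-≗ (λ k → 𝟙-∧ (does (i ∈? s)) (does (k ∈? t)))) ⟩
    ∑[ i < n ] ∑[ k < n ] (𝟙 (does (i ∈? s)) * 𝟙 (does (k ∈? t)))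
      ≡⟨ sum-cong-≗ (λ i → sym (*-distribˡ-sum (𝟙 (does (i ∈? s))) (λ k → 𝟙 (does (k ∈? t))))) ⟩
    ∑[ i < n ] (𝟙 (does (i ∈? s)) * ∑[ k < n ] 𝟙 (does (k ∈? t)))
      ≡⟨ sym (*-distribʳ-sum (∑[ k < n ] 𝟙 (does (k ∈? t))) (λ i → 𝟙 (does (i ∈? s)))) ⟩
    ∑[ i < n ] 𝟙 (does (i ∈? s)) * ∑[ k < n ] 𝟙 (does (k ∈? t))
      ≡⟨ cong₂ _*_ (∑-𝟙-∈ s) (∑-𝟙-∈ t) ⟩
    ∣ s ∣ * ∣ t ∣ ∎

  ∈?-∁ : ∀ {n} (i : Fin n) (s : Subset n) → does (i ∈? ∁ s) ≡ not (does (i ∈? s))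
  ∈?-∁ zero    (inside  ∷ s) = refl
  ∈?-∁ zero    (outside ∷ s) = refl
  ∈?-∁ (suc i) (_       ∷ s) = ∈?-∁ i s

  ∣∁p∣+∣p∣≡n : ∀ {n} (p : Subset n) → ∣ ∁ p ∣ + ∣ p ∣ ≡ n
  ∣∁p∣+∣p∣≡n p = trans (cong (_+ ∣ p ∣) (∣∁p∣≡n∸∣p∣ p)) (m∸n+n≡m (∣p∣≤n p))

  ∑-𝟙-≟ : ∀ {n} (x : Fin n) (f : Fin n → ℕ) → ∑[ i < n ] (𝟙 (does (x ≟ i)) * f i) ≡ f x
  ∑-𝟙-≟ {suc n} zero    f = begin
    (f zero + 0) + ∑[ i < n ] 0 ≡⟨ cong₂ _+_ (+-identityʳ (f zero)) (sum-replicate-zero n) ⟩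
    f zero + 0                  ≡⟨ +-identityʳ (f zero) ⟩
    f zero                      ∎
  ∑-𝟙-≟ {suc n} (suc x) f = ∑-𝟙-≟ x (λ i → f (suc i))

  ∑∑-𝟙-≟ : ∀ {m n} (x : Fin m) (y : Fin n) (f : Fin m → Fin n → ℕ) →
    ∑[ i < m ] ∑[ k < n ] (𝟙 (does (x ≟ i)) * (𝟙 (does (y ≟ k)) * f i k)) ≡ f x y
  ∑∑-𝟙-≟ {m} {n} x y f = begin
    ∑[ i < m ] ∑[ k < n ] (𝟙 (does (x ≟ i)) * (𝟙 (does (y ≟ k)) * f i k))
      ≡⟨ sum-cong-≗ (λ i → sym (*-distribˡ-sum (𝟙 (does (x ≟ i))) (λ k → 𝟙 (does (y ≟ k)) * f i k))) ⟩
    ∑[ i < m ] (𝟙 (does (x ≟ i)) * ∑[ k < n ] (𝟙 (does (y ≟ k)) * f i k))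
      ≡⟨ sum-cong-≗ (λ i → cong (𝟙 (does (x ≟ i)) *_) (∑-𝟙-≟ y (f i))) ⟩
    ∑[ i < m ] (𝟙 (does (x ≟ i)) * f i y)
      ≡⟨ ∑-𝟙-≟ x (λ i → f i y) ⟩
    f x y ∎

  ∑∑-distrib-+ : ∀ {m n} (f g : Fin m → Fin n → ℕ) →
    ∑[ i < m ] ∑[ k < n ] (f i k + g i k) ≡ ∑[ i < m ] ∑[ k < n ] f i k + ∑[ i < m ] ∑[ k < n ] g i k
  ∑∑-distrib-+ f g = trans (sum-cong-≗ (λ i → ∑-distrib-+ (f i) (g i)))
    (∑-distrib-+ (λ i → ∑[ k < _ ] f i k) (λ i → ∑[ k < _ ] g i k))

  -- A file of a direction is indexed by the two coordinates g₁, g₂ that it fixes: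
  -- (cx, cz) for y-files, (cx, cy) for z-files and (cy, cz) for x-files.
  module Files {n} (g₁ g₂ : Cell n → Fin n) where

    occupied : List (Cell n) → Fin n → Fin n → Bool
    occupied P i k = does (any? (λ p → (g₁ p ≟ i) ×-dec (g₂ p ≟ k)) P)

    emptyFiles : Subset n → Subset n → List (Cell n) → ℕ
    emptyFiles A C P =
      ∑[ i < n ] ∑[ k < n ] 𝟙 (does (i ∈? A) ∧ (does (k ∈? C) ∧ not (occupied P i k)))

    rooksInBrick : Subset n → Subset n → List (Cell n) → ℕ
    rooksInBrick A C P = length (filter (λ p → (g₁ p ∈? A) ×-dec (g₂ p ∈? C)) P)

    InDistinctFiles : Cell n → Cell n → Set
    InDistinctFiles p q = ¬ (g₁ p ≡ g₁ q × g₂ p ≡ g₂ q)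

    file-unoccupied : ∀ {p P} → All (InDistinctFiles p) P → occupied P (g₁ p) (g₂ p) ≡ false
    file-unoccupied [] = refl
    file-unoccupied {p} {q ∷ P} (d ∷ ds) with g₁ q ≟ g₁ p | g₂ q ≟ g₂ p
    ... | yes e₁ | yes e₂ = ⊥-elim (d (sym e₁ , sym e₂))
    ... | yes _  | no _   = file-unoccupied ds
    ... | no _   | _      = file-unoccupied ds

    -- Adding p fills exactly the file of p, which was still empty since no rook of P shares it.
    emptyFiles-∷ : ∀ A C {p P} → All (InDistinctFiles p) P →
      emptyFiles A C P ≡ emptyFiles A C (p ∷ P) + 𝟙 (does (g₁ p ∈? A) ∧ does (g₂ p ∈? C))
    emptyFiles-∷ A C {p} {P} ds = begin
      emptyFiles A C P
        ≡⟨ sum-cong-≗ (λ i → sum-cong-≗ (λ k → split i k)) ⟩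
      ∑[ i < n ] ∑[ k < n ] (empty (p ∷ P) i k + 𝟙 (does (g₁ p ≟ i)) * (𝟙 (does (g₂ p ≟ k)) * inBrick i k))
        ≡⟨ ∑∑-distrib-+ (empty (p ∷ P)) (λ i k → 𝟙 (does (g₁ p ≟ i)) * (𝟙 (does (g₂ p ≟ k)) * inBrick i k)) ⟩
      emptyFiles A C (p ∷ P) + ∑[ i < n ] ∑[ k < n ] (𝟙 (does (g₁ p ≟ i)) * (𝟙 (does (g₂ p ≟ k)) * inBrick i k))
        ≡⟨ cong (emptyFiles A C (p ∷ P) +_) (∑∑-𝟙-≟ (g₁ p) (g₂ p) inBrick) ⟩
      emptyFiles A C (p ∷ P) + inBrick (g₁ p) (g₂ p) ∎
      where
      inBrick : Fin n → Fin n → ℕ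
      inBrick i k = 𝟙 (does (i ∈? A) ∧ does (k ∈? C))

      empty : List (Cell n) → Fin n → Fin n → ℕ
      empty Q i k = 𝟙 (does (i ∈? A) ∧ (does (k ∈? C) ∧ not (occupied Q i k)))

      newly-occupied : ∀ x y → 𝟙 (x ∧ (y ∧ true)) ≡ 𝟙 (x ∧ (y ∧ false)) + 1 * (1 * 𝟙 (x ∧ y))
      newly-occupied true  true  = refl
      newly-occupied true  false = refl
      newly-occupied false _     = refl

      split : ∀ i k → empty P i k ≡
        𝟙 (does (i ∈? A) ∧ (does (k ∈? C) ∧ not ((does (g₁ p ≟ i) ∧ does (g₂ p ≟ k)) ∨ occupied P i k)))
          + 𝟙 (does (g₁ p ≟ i)) * (𝟙 (does (g₂ p ≟ k)) * inBrick i k)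
      split i k with g₁ p ≟ i | g₂ p ≟ k
      ... | yes refl | yes refl rewrite file-unoccupied ds = newly-occupied (does (i ∈? A)) (does (k ∈? C))
      ... | yes _    | no _     = sym (+-identityʳ (empty P i k))
      ... | no _     | _        = sym (+-identityʳ (empty P i k))

    emptyFiles+rooksInBrick : ∀ A C {P} → AllPairs InDistinctFiles P →
      emptyFiles A C P + rooksInBrick A C P ≡ ∣ A ∣ * ∣ C ∣
    emptyFiles+rooksInBrick A C {[]} [] = begin
      emptyFiles A C [] + 0
        ≡⟨ +-identityʳ (emptyFiles A C []) ⟩
      emptyFiles A C []
        ≡⟨ sum-cong-≗ (λ i → sum-cong-≗ (λ k → cong (λ b → 𝟙 (does (i ∈? A) ∧ b)) (∧-identityʳ (does (k ∈? C))))) ⟩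
      ∑[ i < n ] ∑[ k < n ] 𝟙 (does (i ∈? A) ∧ does (k ∈? C))
        ≡⟨ ∑∑-𝟙-∈× A C ⟩
      ∣ A ∣ * ∣ C ∣ ∎
    emptyFiles+rooksInBrick A C {p ∷ P} (ds ∷ dss) = begin
      emptyFiles A C (p ∷ P) + rooksInBrick A C (p ∷ P)
        ≡⟨ cong (emptyFiles A C (p ∷ P) +_) (length-filter-∷ _ p P) ⟩
      emptyFiles A C (p ∷ P) + (𝟙 (does (g₁ p ∈? A) ∧ does (g₂ p ∈? C)) + rooksInBrick A C P)
        ≡⟨ sym (+-assoc (emptyFiles A C (p ∷ P)) _ _) ⟩
      emptyFiles A C (p ∷ P) + 𝟙 (does (g₁ p ∈? A) ∧ does (g₂ p ∈? C)) + rooksInBrick A C P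
        ≡⟨ cong (_+ rooksInBrick A C P) (sym (emptyFiles-∷ A C ds)) ⟩
      emptyFiles A C P + rooksInBrick A C P
        ≡⟨ emptyFiles+rooksInBrick A C dss ⟩
      ∣ A ∣ * ∣ C ∣ ∎

  open Files

  Ey+rooksInBrick : ∀ {n} (A C : Subset n) {P} → AllPairs NonAttacking P →
    Ey A C P + rooksInBrick cx cz A C P ≡ ∣ A ∣ * ∣ C ∣
  Ey+rooksInBrick {n} A C {P} na =
    trans (cong (_+ rooksInBrick cx cz A C P) (length-filter-cartesianProduct _ {n} {n} (λ i → i) (λ k → k)))
      (emptyFiles+rooksInBrick cx cz A C (AllPairs.map (λ nonattacking → proj₂ (proj₂ nonattacking)) na))

  Ez+rooksInBrick : ∀ {n} (A B : Subset n) {P} → AllPairs NonAttacking P →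
    Ez A B P + rooksInBrick cx cy A B P ≡ ∣ A ∣ * ∣ B ∣
  Ez+rooksInBrick {n} A B {P} na =
    trans (cong (_+ rooksInBrick cx cy A B P) (length-filter-cartesianProduct _ {n} {n} (λ i → i) (λ j → j)))
      (emptyFiles+rooksInBrick cx cy A B (AllPairs.map proj₁ na))

  Ex+rooksInBrick : ∀ {n} (B C : Subset n) {P} → AllPairs NonAttacking P →
    Ex B C P + rooksInBrick cy cz B C P ≡ ∣ B ∣ * ∣ C ∣
  Ex+rooksInBrick {n} B C {P} na =
    trans (cong (_+ rooksInBrick cy cz B C P) (length-filter-cartesianProduct _ {n} {n} (λ j → j) (λ k → k)))
      (emptyFiles+rooksInBrick cy cz B C (AllPairs.map (λ nonattacking → proj₁ (proj₂ nonattacking)) na))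

  -- With x, y, z the memberships in I, J, K, the summands are T₀, T₃ and the three bricks.
  octants : ∀ x y z →
    𝟙 (x ∧ (y ∧ z)) + 𝟙 (not x ∧ (not y ∧ not z)) + 𝟙 (not x ∧ z) + 𝟙 (x ∧ not y) + 𝟙 (y ∧ not z) ≡ 1
  octants true  true  true  = refl
  octants true  true  false = refl
  octants true  false true  = refl
  octants true  false false = refl
  octants false true  true  = refl
  octants false true  false = refl
  octants false false true  = refl
  octants false false false = refl

  module _ {n} (I J K : Subset n) where

    cell-partition : ∀ p →
      𝟙 (does (cx p ∈? I) ∧ (does (cy p ∈? J) ∧ does (cz p ∈? K)))
        + 𝟙 (does (cx p ∈? ∁ I) ∧ (does (cy p ∈? ∁ J) ∧ does (cz p ∈? ∁ K)))
        + 𝟙 (does (cx p ∈? ∁ I) ∧ does (cz p ∈? K))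
        + 𝟙 (does (cx p ∈? I) ∧ does (cy p ∈? ∁ J))
        + 𝟙 (does (cy p ∈? J) ∧ does (cz p ∈? ∁ K)) ≡ 1
    cell-partition p rewrite ∈?-∁ (cx p) I | ∈?-∁ (cy p) J | ∈?-∁ (cz p) K =
      octants (does (cx p ∈? I)) (does (cy p ∈? J)) (does (cz p ∈? K))

    rooks-partition : ∀ P →
      rooksIn I J K P + rooksIn (∁ I) (∁ J) (∁ K) P
        + rooksInBrick cx cz (∁ I) K P + rooksInBrick cx cy I (∁ J) P + rooksInBrick cy cz J (∁ K) P
        ≡ length P
    rooks-partition = length-filter-partition₅
      (λ p → (cx p ∈? I) ×-dec ((cy p ∈? J) ×-dec (cz p ∈? K)))
      (λ p → (cx p ∈? ∁ I) ×-dec ((cy p ∈? ∁ J) ×-dec (cz p ∈? ∁ K)))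
      (λ p → (cx p ∈? ∁ I) ×-dec (cz p ∈? K))
      (λ p → (cx p ∈? I) ×-dec (cy p ∈? ∁ J))
      (λ p → (cy p ∈? J) ×-dec (cz p ∈? ∁ K))
      cell-partition

open Counting
open import Data.Nat as ℕ using (ℕ)
open import Data.Integer using (ℤ; +_; _+_; _-_; _*_)
open import Data.Integer.Properties using (pos-+; pos-*)
open import Data.Integer.Tactic.RingSolver using (solve-∀)
open import Data.Fin.Subset using (Subset; ∁; ∣_∣)
open import Data.List using (List; length)
open import Data.List.Relation.Unary.AllPairs using (AllPairs)
open import Relation.Binary.PropositionalEquality

ring-identity : ∀ (N a b c c₀ c₃ y z x : ℤ) →
  N * N - (a + b + c) * N + a * b + b * c + c * a - c₀ - c₃
    ≡ N * N - (c₀ + c₃ + y + z + x) - ((N - a) * c - y) - (a * (N - b) - z) - (b * (N - c) - x)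
ring-identity = solve-∀

m+n≡o⇒+m≡+o-+n : ∀ {m n o} → m ℕ.+ n ≡ o → + m ≡ + o - + n
m+n≡o⇒+m≡+o-+n {m} {n} refl = trans (u≡u+v-v (+ m) (+ n)) (cong (_- + n) (sym (pos-+ m n)))
  where
  u≡u+v-v : ∀ u v → u ≡ u + v - v
  u≡u+v-v = solve-∀

+∣∁p∣≡+n-+∣p∣ : ∀ {n} (p : Subset n) → + ∣ ∁ p ∣ ≡ + n - + ∣ p ∣
+∣∁p∣≡+n-+∣p∣ p = m+n≡o⇒+m≡+o-+n (∣∁p∣+∣p∣≡n p)

m+n≡o*p⇒+m≡+o*+p-+n : ∀ {m n} o p → m ℕ.+ n ≡ o ℕ.* p → + m ≡ + o * + p - + n
m+n≡o*p⇒+m≡+o*+p-+n {n = n} o p eq = trans (m+n≡o⇒+m≡+o-+n eq) (cong (_- + n) (pos-* o p))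

pos-+₅ : ∀ a b c d e → + (a ℕ.+ b ℕ.+ c ℕ.+ d ℕ.+ e) ≡ + a + + b + + c + + d + + e
pos-+₅ a b c d e =
  trans (pos-+ _ e) (cong (_+ + e) (trans (pos-+ _ d) (cong (_+ + d) (trans (pos-+ _ c) (cong (_+ + c) (pos-+ a b))))))

theorem6p8 : (n : ℕ) (P : List (Cell n)) → AllPairs NonAttacking P →
    (I J K : Subset n) →
    let a = + ∣ I ∣
        b = + ∣ J ∣
        c = + ∣ K ∣
        N = + n
        c₀ = + rooksIn I J K P
        c₃ = + rooksIn (∁ I) (∁ J) (∁ K) P
        defT = N * N - (a + b + c) * N + a * b + b * c + c * a - c₀ - c₃
        defH = N * N - + length P
    in defT ≡ defH - + Ey (∁ I) K P - + Ez I (∁ J) P - + Ex J (∁ K) P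
theorem6p8 n P na I J K =
  trans (ring-identity (+ n) (+ ∣ I ∣) (+ ∣ J ∣) (+ ∣ K ∣) (+ c₀) (+ c₃) (+ y) (+ z) (+ x))
    (sym (cong₂ _-_ (cong₂ _-_ (cong₂ _-_ (cong (+ n * + n -_) total) emptyY) emptyZ) emptyX))
  where
  open Files
  c₀ c₃ y z x : ℕ
  c₀ = rooksIn I J K P
  c₃ = rooksIn (∁ I) (∁ J) (∁ K) P
  y = rooksInBrick cx cz (∁ I) K P
  z = rooksInBrick cx cy I (∁ J) P
  x = rooksInBrick cy cz J (∁ K) P

  total : + length P ≡ + c₀ + + c₃ + + y + + z + + x
  total = trans (cong +_ (sym (rooks-partition I J K P))) (pos-+₅ c₀ c₃ y z x)

  emptyY : + Ey (∁ I) K P ≡ (+ n - + ∣ I ∣) * + ∣ K ∣ - + y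
  emptyY = trans (m+n≡o*p⇒+m≡+o*+p-+n ∣ ∁ I ∣ ∣ K ∣ (Ey+rooksInBrick (∁ I) K na))
                 (cong (λ s → s * + ∣ K ∣ - + y) (+∣∁p∣≡+n-+∣p∣ I))

  emptyZ : + Ez I (∁ J) P ≡ + ∣ I ∣ * (+ n - + ∣ J ∣) - + z
  emptyZ = trans (m+n≡o*p⇒+m≡+o*+p-+n ∣ I ∣ ∣ ∁ J ∣ (Ez+rooksInBrick I (∁ J) na))
                 (cong (λ s → + ∣ I ∣ * s - + z) (+∣∁p∣≡+n-+∣p∣ J))

  emptyX : + Ex J (∁ K) P ≡ + ∣ J ∣ * (+ n - + ∣ K ∣) - + x
  emptyX = trans (m+n≡o*p⇒+m≡+o*+p-+n ∣ J ∣ ∣ ∁ K ∣ (Ex+rooksInBrick J (∁ K) na))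
                 (cong (λ s → + ∣ J ∣ * s - + x) (+∣∁p∣≡+n-+∣p∣ K))
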